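{- Let $p$ be an odd prime, $\alpha$ a positive integer, $n=p^{\alpha}$, and let $a_1,\ldots,a_n\in\mathbb{Z}$. Suppose that either $\sum_{k=1}^n a_k\not\equiv 0\pmod p$, or $a_1\equiv a_2\equiv\cdots\equiv a_n\pmod p$. Then there exists a permutation $\sigma$ of $\{1,\ldots,n\}$ such that $$\sum_{k=1}^n k\,a_{\sigma(k)}\equiv 0\pmod n.$$ -}

module Defs where

open import Data.Nat using (ℕ; zero; suc)
open import Data.Fin using (Fin; zero; suc)
open import Data.Integer using (ℤ; _+_; 0ℤ)

-- Σ over Fin n of f i  (i ranges over Fin n, representing indices 1..n via toℕ i + 1)
∑ : (n : ℕ) → (Fin n → ℤ) → ℤ
∑ zero    f = 0ℤ
∑ (suc n) f = f zero + ∑ n (λ i → f (suc i))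

-- Write S(c) = Σ_k (k + 1) c_k.  Cycling the first m entries of c by one step changes S(c) by
-- −(c_0 + ⋯ + c_{m−1}) modulo m, so when m = p^e and this prefix sum is prime to p, a suitable
-- number of such cycles makes S divisible by p^e.  By induction on e ≤ α, every c of length
-- n = p^(α+1) can be rearranged so that p^e ∣ S: if all entries are congruent to c_0 modulo p,
-- write c_k = c_0 + p b_k; as n is odd, n divides 1 + 2 + ⋯ + n, so S(c) ≡ p S(b) modulo p^(α+1)
-- and the induction hypothesis for b applies.  Otherwise two entries are incongruent, and the
-- proper prefix of length p^e can be filled so that its sum is prime to p.  The two hypotheses of
-- the theorem provide the same two cases for the last step, the whole sequence being the prefix.

module Submission where

open import Defs
open import Data.Empty using (⊥-elim)
open import Data.Fin using (Fin; zero; suc; toℕ; punchIn; punchOut; _≟_)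
open import Data.Fin.Permutation using (Permutation′; _⟨$⟩ʳ_; _∘ₚ_; id; lift₀; insert; transpose)
open import Data.Fin.Properties using (all?; ¬∀⟶∃¬; punchIn-punchOut)
open import Data.Integer using (ℤ; +_; _+_; _-_; _*_; -_; 0ℤ; 1ℤ; _%ℕ_; _/ℕ_)
import Data.Integer.Coprimality as ℤ
open import Data.Integer.DivMod using (a≡a%ℕn+[a/ℕn]*n)
import Data.Integer.Divisibility as Unsigned
open import Data.Integer.Divisibility.Signed
import Data.Integer.Properties as ℤP
open import Data.Integer.Tactic.RingSolver using (solve-∀)
open import Data.Nat as ℕ using (ℕ; zero; suc; _^_; _≤_; s≤s; z≤n; NonZero)
open import Data.Nat.Coprimality as Coprimality using (Coprime; coprime-Bézout)
import Data.Nat.Divisibility as ℕ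
import Data.Nat.GCD as GCD
open import Data.Nat.Primality using (Prime; prime⇒irreducible; prime⇒nonZero; prime⇒nonTrivial; prime[2]; ¬prime[1]; euclidsLemma)
import Data.Nat.Properties as ℕP
open import Data.Product using (∃; _×_; _,_; proj₂)
open import Data.Sum as ⊎ using (_⊎_; inj₁; inj₂)
open import Data.Vec.Functional using (tail)
open import Algebra.Properties.Semiring.Sum ℤP.+-*-semiring
  using (sum; sum-syntax; sum-cong-≗; ∑-distrib-+; *-distribˡ-sum; ∑-permute)
open import Relation.Binary.PropositionalEquality
open import Relation.Nullary using (¬_; yes; no)

infixl 9 _∘ʳ_
_∘ʳ_ : ∀ {A : Set} {n} → (Fin n → A) → Permutation′ n → Fin n → A
(c ∘ʳ π) k = c (π ⟨$⟩ʳ k)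

sum-∘ʳ : ∀ {n} (c : Fin n → ℤ) π → sum (c ∘ʳ π) ≡ sum c
sum-∘ʳ c π = sym (∑-permute c π)

∑≡sum : ∀ n (f : Fin n → ℤ) → ∑ n f ≡ sum f
∑≡sum zero    f = refl
∑≡sum (suc n) f = cong (λ s → f zero + s) (∑≡sum n (tail f))

weightedSum : ∀ {n} → (Fin n → ℤ) → ℤ
weightedSum {n} f = ∑[ k < n ] (+ suc (toℕ k) * f k)

triangular : ℕ → ℤ
triangular n = weightedSum {n} (λ _ → 1ℤ)

weightedSum-suc : ∀ {n} (f : Fin (suc n) → ℤ) → weightedSum f ≡ sum f + weightedSum (tail f)
weightedSum-suc {n} f = begin
  + 1 * f zero + ∑[ k < n ] ((1ℤ + + suc (toℕ k)) * f (suc k))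
    ≡⟨ cong₂ _+_ (ℤP.*-identityˡ (f zero)) (sum-cong-≗ {n} λ k → split (+ suc (toℕ k)) (f (suc k))) ⟩
  f zero + ∑[ k < n ] (f (suc k) + + suc (toℕ k) * f (suc k))
    ≡⟨ cong (λ s → f zero + s) (∑-distrib-+ {n} (tail f) _) ⟩
  f zero + (sum (tail f) + weightedSum (tail f))
    ≡⟨ ℤP.+-assoc (f zero) _ _ ⟨
  sum f + weightedSum (tail f) ∎
  where
  open ≡-Reasoning
  split : ∀ w x → (1ℤ + w) * x ≡ x + w * x
  split = solve-∀

weightedSum-affine : ∀ {n} x y (f : Fin n → ℤ) →
  weightedSum (λ k → x + y * f k) ≡ x * triangular n + y * weightedSum f
weightedSum-affine {n} x y f = begin
  ∑[ k < n ] (+ suc (toℕ k) * (x + y * f k))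
    ≡⟨ sum-cong-≗ {n} (λ k → expand x y (+ suc (toℕ k)) (f k)) ⟩
  ∑[ k < n ] (x * (+ suc (toℕ k) * 1ℤ) + y * (+ suc (toℕ k) * f k))
    ≡⟨ ∑-distrib-+ {n} _ _ ⟩
  ∑[ k < n ] (x * (+ suc (toℕ k) * 1ℤ)) + ∑[ k < n ] (y * (+ suc (toℕ k) * f k))
    ≡⟨ cong₂ _+_ (*-distribˡ-sum {n} x _) (*-distribˡ-sum {n} y _) ⟨
  x * triangular n + y * weightedSum f ∎
  where
  open ≡-Reasoning
  expand : ∀ x y w z → w * (x + y * z) ≡ x * (w * 1ℤ) + y * (w * z)
  expand = solve-∀

sum-ones : ∀ n → sum {n} (λ _ → 1ℤ) ≡ + n
sum-ones zero    = refl
sum-ones (suc n) = cong (λ s → 1ℤ + s) (sum-ones n)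

2*triangular[n]≡n*[1+n] : ∀ n → + 2 * triangular n ≡ + n * + suc n
2*triangular[n]≡n*[1+n] zero    = refl
2*triangular[n]≡n*[1+n] (suc n) = begin
  + 2 * triangular (suc n)
    ≡⟨ cong (+ 2 *_) (weightedSum-suc {n} (λ _ → 1ℤ)) ⟩
  + 2 * (sum {suc n} (λ _ → 1ℤ) + triangular n)
    ≡⟨ ℤP.*-distribˡ-+ (+ 2) (sum {suc n} (λ _ → 1ℤ)) _ ⟩
  + 2 * sum {suc n} (λ _ → 1ℤ) + + 2 * triangular n
    ≡⟨ cong₂ (λ s w → + 2 * s + w) (sum-ones (suc n)) (2*triangular[n]≡n*[1+n] n) ⟩
  + 2 * (1ℤ + + n) + + n * (1ℤ + + n)
    ≡⟨ gauss (+ n) ⟩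
  (1ℤ + + n) * (1ℤ + (1ℤ + + n)) ∎
  where
  open ≡-Reasoning
  gauss : ∀ m → + 2 * (1ℤ + m) + m * (1ℤ + m) ≡ (1ℤ + m) * (1ℤ + (1ℤ + m))
  gauss = solve-∀

prefixSum : ℕ → ∀ {n} → (Fin n → ℤ) → ℤ
prefixSum zero    f = 0ℤ
prefixSum (suc L) {zero}  f = 0ℤ
prefixSum (suc L) {suc n} f = f zero + prefixSum L (tail f)

prefixSum-all : ∀ n (f : Fin n → ℤ) → prefixSum n f ≡ sum f
prefixSum-all zero    f = refl
prefixSum-all (suc n) f = cong (λ s → f zero + s) (prefixSum-all n (tail f))

-- c ∘ʳ rotate L n = (c 1, …, c L, c 0, c (L + 1), …): the first L + 1 entries are cycled by one step.
rotate : ℕ → (n : ℕ) → Permutation′ (suc n)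
rotate zero    n       = id
rotate (suc L) zero    = id
rotate (suc L) (suc n) = lift₀ (rotate L n) ∘ₚ transpose zero (suc zero)

prefixSum-rotate : ∀ {L n} → L ≤ n → (c : Fin (suc n) → ℤ) →
                   prefixSum (suc L) (c ∘ʳ rotate L n) ≡ prefixSum (suc L) c
prefixSum-rotate {zero}            _         c = refl
prefixSum-rotate {suc L} {suc n} (s≤s L≤n) c = begin
  c (suc zero) + prefixSum (suc L) (d ∘ʳ rotate L n)
    ≡⟨ cong (λ s → c (suc zero) + s) (prefixSum-rotate L≤n d) ⟩
  c (suc zero) + (c zero + prefixSum L (tail (tail c)))
    ≡⟨ swap-head (c (suc zero)) (c zero) _ ⟩
  c zero + (c (suc zero) + prefixSum L (tail (tail c))) ∎
  where
  open ≡-Reasoning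
  d : Fin (suc n) → ℤ
  d = tail (c ∘ʳ transpose zero (suc zero))
  swap-head : ∀ a b x → a + (b + x) ≡ b + (a + x)
  swap-head = solve-∀

weightedSum-rotate : ∀ {L n} → L ≤ n → (c : Fin (suc n) → ℤ) →
  weightedSum (c ∘ʳ rotate L n) ≡ weightedSum c - prefixSum (suc L) c + + suc L * c zero
weightedSum-rotate {zero} _ c = shift (weightedSum c) (c zero)
  where
  shift : ∀ s a → s ≡ s - (a + 0ℤ) + 1ℤ * a
  shift = solve-∀
weightedSum-rotate {suc L} {suc n} (s≤s L≤n) c = begin
  weightedSum (c ∘ʳ rotate (suc L) (suc n))
    ≡⟨ weightedSum-suc (c ∘ʳ rotate (suc L) (suc n)) ⟩
  sum (c ∘ʳ rotate (suc L) (suc n)) + weightedSum (d ∘ʳ rotate L n)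
    ≡⟨ cong₂ _+_ (sum-∘ʳ c (rotate (suc L) (suc n))) (weightedSum-rotate L≤n d) ⟩
  sum c + (weightedSum d - (c₀ + prefixSum L t) + + suc L * c₀)
    ≡⟨ cong (λ s → sum c + (s - (c₀ + prefixSum L t) + + suc L * c₀)) (weightedSum-suc d) ⟩
  sum c + (c₀ + sum t + weightedSum t - (c₀ + prefixSum L t) + + suc L * c₀)
    ≡⟨ rearrange (sum c) c₀ c₁ (sum t) (weightedSum t) (prefixSum L t) (+ suc L) ⟩
  sum c + (c₁ + sum t + weightedSum t) - (c₀ + (c₁ + prefixSum L t)) + (1ℤ + + suc L) * c₀
    ≡⟨ cong (λ s → sum c + s - prefixSum (suc (suc L)) c + + suc (suc L) * c₀) (weightedSum-suc (tail c)) ⟨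
  sum c + weightedSum (tail c) - prefixSum (suc (suc L)) c + + suc (suc L) * c₀
    ≡⟨ cong (λ s → s - prefixSum (suc (suc L)) c + + suc (suc L) * c₀) (weightedSum-suc c) ⟨
  weightedSum c - prefixSum (suc (suc L)) c + + suc (suc L) * c₀ ∎
  where
  open ≡-Reasoning
  c₀ = c zero
  c₁ = c (suc zero)
  d : Fin (suc n) → ℤ
  d = tail (c ∘ʳ transpose zero (suc zero))
  t : Fin n → ℤ
  t = tail (tail c)
  rearrange : ∀ σ a b s w u l →
    σ + (a + s + w - (a + u) + l * a) ≡ σ + (b + s + w) - (a + (b + u)) + (1ℤ + l) * a
  rearrange = solve-∀

rotate^ : ℕ → (L n : ℕ) → Permutation′ (suc n)
rotate^ zero    L n = id
rotate^ (suc t) L n = rotate^ t L n ∘ₚ rotate L n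

rotate^-divides : ∀ {L n} → L ≤ n → ∀ t (c : Fin (suc n) → ℤ) →
  + suc L ∣ weightedSum c - + t * prefixSum (suc L) c → + suc L ∣ weightedSum (c ∘ʳ rotate^ t L n)
rotate^-divides {L} _ zero c m∣ = subst (_ ∣_) (no-shift (weightedSum c) (prefixSum (suc L) c)) m∣
  where
  no-shift : ∀ s u → s - 0ℤ * u ≡ s
  no-shift = solve-∀
rotate^-divides {L} {n} L≤n (suc t) c m∣ =
  rotate^-divides L≤n t (c ∘ʳ rotate L n) (subst (_ ∣_) shifted (∣m∣n⇒∣m+n m∣ (∣m⇒∣m*n {+ suc L} (c zero) ∣-refl)))
  where
  open ≡-Reasoning
  shifted : weightedSum c - + suc t * prefixSum (suc L) c + + suc L * c zero
          ≡ weightedSum (c ∘ʳ rotate L n) - + t * prefixSum (suc L) (c ∘ʳ rotate L n)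
  shifted = begin
    weightedSum c - (1ℤ + + t) * prefixSum (suc L) c + + suc L * c zero
      ≡⟨ regroup (weightedSum c) (+ t) (prefixSum (suc L) c) (+ suc L * c zero) ⟩
    weightedSum c - prefixSum (suc L) c + + suc L * c zero - + t * prefixSum (suc L) c
      ≡⟨ cong₂ (λ w u → w - + t * u) (weightedSum-rotate L≤n c) (prefixSum-rotate L≤n c) ⟨
    weightedSum (c ∘ʳ rotate L n) - + t * prefixSum (suc L) (c ∘ʳ rotate L n) ∎
    where
    regroup : ∀ s t u x → s - (1ℤ + t) * u + x ≡ s - u + x - t * u
    regroup = solve-∀

rotation-balances : ∀ {L n} → L ≤ n → (c : Fin (suc n) → ℤ) → ∀ t →
  + suc L ∣ weightedSum c - t * prefixSum (suc L) c → ∃ λ π → + suc L ∣ weightedSum (c ∘ʳ π)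
rotation-balances {L} {n} L≤n c t m∣ =
  rotate^ (t %ℕ suc L) L n ,
  rotate^-divides L≤n (t %ℕ suc L) c (subst (_ ∣_) reduce (∣m∣n⇒∣m+n m∣ (∣n⇒∣m*n (t /ℕ suc L * U) ∣-refl)))
  where
  open ≡-Reasoning
  U = prefixSum (suc L) c
  reduce : weightedSum c - t * U + t /ℕ suc L * U * + suc L ≡ weightedSum c - + (t %ℕ suc L) * U
  reduce = begin
    weightedSum c - t * U + t /ℕ suc L * U * + suc L
      ≡⟨ cong (λ z → weightedSum c - z * U + t /ℕ suc L * U * + suc L) (a≡a%ℕn+[a/ℕn]*n t (suc L)) ⟩
    weightedSum c - (+ (t %ℕ suc L) + t /ℕ suc L * + suc L) * U + t /ℕ suc L * U * + suc L
      ≡⟨ cancel (weightedSum c) (+ (t %ℕ suc L)) (t /ℕ suc L) (+ suc L) U ⟩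
    weightedSum c - + (t %ℕ suc L) * U ∎
    where
    cancel : ∀ s r q m u → s - (r + q * m) * u + q * u * m ≡ s - r * u
    cancel = solve-∀

prime∤⇒coprime : ∀ {p n} → Prime p → ¬ p ℕ.∣ n → Coprime p n
prime∤⇒coprime p-prime p∤n (d∣p , d∣n) with prime⇒irreducible p-prime d∣p
... | inj₁ d≡1  = d≡1
... | inj₂ refl = ⊥-elim (p∤n d∣n)

coprime⇒inverse : ∀ {p n} → Coprime p n → ∃ λ u → + p ∣ u * + n - 1ℤ
coprime⇒inverse {p} {n} coprime with coprime-Bézout coprime
... | GCD.Bézout.+- x y eq = - + y , divides (- + x) (begin
  - + y * + n - 1ℤ    ≡⟨ negate (+ y) (+ n) ⟩
  - (1ℤ + + y * + n)  ≡⟨ cong (λ z → - (1ℤ + z)) (ℤP.pos-* y n) ⟨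
  - + (1 ℕ.+ y ℕ.* n) ≡⟨ cong (λ z → - + z) eq ⟩
  - + (x ℕ.* p)       ≡⟨ cong -_ (ℤP.pos-* x p) ⟩
  - (+ x * + p)       ≡⟨ ℤP.neg-distribˡ-* (+ x) (+ p) ⟩
  - + x * + p         ∎)
  where
  open ≡-Reasoning
  negate : ∀ a b → - a * b - 1ℤ ≡ - (1ℤ + a * b)
  negate = solve-∀
... | GCD.Bézout.-+ x y eq = + y , divides (+ x) (begin
  + y * + n - 1ℤ        ≡⟨ cong (_- 1ℤ) (ℤP.pos-* y n) ⟨
  + (y ℕ.* n) - 1ℤ      ≡⟨ cong (λ z → + z - 1ℤ) eq ⟨
  1ℤ + + (x ℕ.* p) - 1ℤ ≡⟨ cancel (+ (x ℕ.* p)) ⟩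
  + (x ℕ.* p)           ≡⟨ ℤP.pos-* x p ⟩
  + x * + p             ∎)
  where
  open ≡-Reasoning
  cancel : ∀ a → 1ℤ + a - 1ℤ ≡ a
  cancel = solve-∀

inverse-mod-prime : ∀ {p v} → Prime p → ¬ + p ∣ v → ∃ λ u → + p ∣ u * v - 1ℤ
inverse-mod-prime {p} {v} p-prime p∤v with coprime⇒inverse (prime∤⇒coprime p-prime (λ p∣∣v∣ → p∤v (∣ᵤ⇒∣ p∣∣v∣)))
... | u , p∣ with m∣∣m∣ {v}
... | divides e ∣v∣≡ev = u * e , subst (λ w → + p ∣ w - 1ℤ) (trans (cong (u *_) ∣v∣≡ev) (sym (ℤP.*-assoc u e v))) p∣

solve-mod-prime-power : ∀ {p v} → Prime p → ¬ + p ∣ v → ∀ e s → ∃ λ t → + (p ^ e) ∣ s - t * v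
solve-mod-prime-power _ _ zero s = 0ℤ , ∣ᵤ⇒∣ (ℕ.1∣ _)
solve-mod-prime-power {p} {v} p-prime p∤v (suc e) s
  with solve-mod-prime-power p-prime p∤v e s | inverse-mod-prime p-prime p∤v
... | t , divides q s-tv≡ | u , divides k uv-1≡ = t + q * u * + (p ^ e) , divides (- (q * k)) (begin
  s - (t + q * u * P) * v             ≡⟨ lift s t q u P v ⟩
  (s - t * v) - q * P * (u * v - 1ℤ) - q * P ≡⟨ cong₂ (λ x y → x - q * P * y - q * P) s-tv≡ uv-1≡ ⟩
  q * P - q * P * (k * + p) - q * P   ≡⟨ collect q P k (+ p) ⟩
  - (q * k) * (+ p * P)               ≡⟨ cong (λ z → - (q * k) * z) (ℤP.pos-* p (p ^ e)) ⟨
  - (q * k) * + (p ^ suc e)           ∎)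
  where
  open ≡-Reasoning
  P = + (p ^ e)
  -- Hensel lifting: t is corrected by a multiple of p ^ e, using the inverse u of v modulo p.
  lift : ∀ s t q u P v → s - (t + q * u * P) * v ≡ (s - t * v) - q * P * (u * v - 1ℤ) - q * P
  lift = solve-∀
  collect : ∀ q P k p → q * P - q * P * (k * p) - q * P ≡ - (q * k) * (p * P)
  collect = solve-∀

prime-power-prefix-balances : ∀ {p e L n} → Prime p → L ≤ n → suc L ≡ p ^ e → (c : Fin (suc n) → ℤ) →
  ¬ + p ∣ prefixSum (suc L) c → ∃ λ π → + (p ^ e) ∣ weightedSum (c ∘ʳ π)
prime-power-prefix-balances {p} {e} p-prime L≤n sL≡pᵉ c p∤U
  with solve-mod-prime-power p-prime p∤U e (weightedSum c)
... | t , pᵉ∣ with rotation-balances L≤n c t (subst (λ m → + m ∣ _) (sym sL≡pᵉ) pᵉ∣)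
... | π , sL∣ = π , subst (λ m → + m ∣ _) sL≡pᵉ sL∣

move-to-front : ∀ {n} → Fin (suc n) → Permutation′ (suc n)
move-to-front k = insert zero k id

third-index : ∀ {n} (i j : Fin (suc (suc (suc n)))) → ∃ λ k → k ≢ i × k ≢ j
third-index i j with zero ≟ i | zero ≟ j
... | no 0≢i    | no 0≢j = zero , 0≢i , 0≢j
... | yes refl  | _ with suc zero ≟ j
...   | no 1≢j   = suc zero , (λ ()) , 1≢j
...   | yes refl = suc (suc zero) , (λ ()) , (λ ())
third-index i j | no 0≢i | yes refl with suc zero ≟ i
...   | no 1≢i   = suc zero , 1≢i , (λ ())
...   | yes refl = suc (suc zero) , (λ ()) , (λ ())

prefixSum-avoids : ∀ d {B n} → suc B ≤ n → (c : Fin (suc n) → ℤ) {i j : Fin (suc n)} →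
  ¬ d ∣ c i - c j → ∀ r → ∃ λ π → ¬ d ∣ prefixSum (suc B) (c ∘ʳ π) - r
prefixSum-avoids d {zero} _ c {i} {j} d∤ r with d ∣? c i - r
... | no d∤cᵢ-r  = move-to-front i , λ d∣ → d∤cᵢ-r (subst (λ x → d ∣ x - r) (ℤP.+-identityʳ (c i)) d∣)
... | yes d∣cᵢ-r = move-to-front j , λ d∣ →
  d∤ (subst (d ∣_) (difference (c i) (c j) r) (∣m∣n⇒∣m-n d∣cᵢ-r d∣))
  where
  difference : ∀ a b r → a - r - (b + 0ℤ - r) ≡ a - b
  difference = solve-∀
prefixSum-avoids d {suc B} {suc (suc n)} (s≤s B<n) c {i} {j} d∤ r with third-index i j
... | k , k≢i , k≢j with prefixSum-avoids d B<n (λ t → c (punchIn k t)) {punchOut k≢i} {punchOut k≢j}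
                           (subst₂ (λ a b → ¬ d ∣ c a - c b) (sym (punchIn-punchOut k≢i)) (sym (punchIn-punchOut k≢j)) d∤)
                           (r - c k)
... | π , d∤U = lift₀ π ∘ₚ move-to-front k , λ d∣ → d∤U (subst (d ∣_) (shift (c k) _ r) d∣)
  where
  shift : ∀ a u r → a + u - r ≡ u - (r - a)
  shift = solve-∀

prime≢2⇒odd : ∀ {p} → Prime p → p ≢ 2 → ¬ 2 ℕ.∣ p
prime≢2⇒odd p-prime p≢2 2∣p with prime⇒irreducible p-prime 2∣p
... | inj₁ ()
... | inj₂ 2≡p = p≢2 (sym 2≡p)

prime∤⇒∤^ : ∀ {q m} → Prime q → ¬ q ℕ.∣ m → ∀ k → ¬ q ℕ.∣ m ^ k
prime∤⇒∤^ q-prime _ zero q∣1 = ¬prime[1] (subst Prime (ℕ.∣1⇒≡1 q∣1) q-prime)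
prime∤⇒∤^ {m = m} q-prime q∤m (suc k) q∣mᵏ⁺¹ with euclidsLemma m (m ^ k) q-prime q∣mᵏ⁺¹
... | inj₁ q∣m  = q∤m q∣m
... | inj₂ q∣mᵏ = prime∤⇒∤^ q-prime q∤m k q∣mᵏ

^-monoʳ-∣ : ∀ m {i j} → i ≤ j → m ^ i ℕ.∣ m ^ j
^-monoʳ-∣ m z≤n       = ℕ.1∣ _
^-monoʳ-∣ m (s≤s i≤j) = ℕ.*-monoʳ-∣ m (^-monoʳ-∣ m i≤j)

odd⇒∣triangular : ∀ {n} → ¬ 2 ℕ.∣ n → + n ∣ triangular n
odd⇒∣triangular {n} 2∤n = ∣ᵤ⇒∣ (ℤ.coprime-divisor (+ n) (+ 2) (triangular n) n⊥2 (∣⇒∣ᵤ n∣2T))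
  where
  n⊥2 : Coprime n 2
  n⊥2 = Coprimality.sym (prime∤⇒coprime prime[2] 2∤n)
  n∣2T : + n ∣ + 2 * triangular n
  n∣2T = divides (+ suc n) (trans (2*triangular[n]≡n*[1+n] n) (ℤP.*-comm (+ n) (+ suc n)))

weightedSum-affine-∣ : ∀ {n} {x y : ℤ} (c b : Fin n → ℤ) → (∀ k → c k ≡ x + y * b k) → ∀ {m} →
  y * m ∣ triangular n → m ∣ weightedSum b → y * m ∣ weightedSum c
weightedSum-affine-∣ {n} {x} {y} c b c≡ ym∣T m∣ =
  subst (_ ∣_) (trans (sym (weightedSum-affine x y b)) (sum-cong-≗ {n} λ k → cong (+ suc (toℕ k) *_) (sym (c≡ k))))
        (∣m∣n⇒∣m+n (∣n⇒∣m*n x ym∣T) (*-monoʳ-∣ y m∣))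

module _ {p α n : ℕ} (p-prime : Prime p) (p-odd : ¬ 2 ℕ.∣ p) (N≡pᵅ⁺¹ : suc n ≡ p ^ suc α) where

  private
    instance
      p≢0 : NonZero p
      p≢0 = prime⇒nonZero p-prime

  pᵉ∣triangular : ∀ {e} → e ≤ suc α → + (p ^ e) ∣ triangular (suc n)
  pᵉ∣triangular {e} e≤ = ∣-trans (∣ᵤ⇒∣ {+ (p ^ e)} {+ (p ^ suc α)} (^-monoʳ-∣ p e≤))
    (subst (λ m → + m ∣ triangular (suc n)) N≡pᵅ⁺¹ (odd⇒∣triangular N-odd))
    where
    N-odd : ¬ 2 ℕ.∣ suc n
    N-odd = subst (λ m → ¬ 2 ℕ.∣ m) (sym N≡pᵅ⁺¹) (prime∤⇒∤^ prime[2] p-odd (suc α))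

  congruent-step : ∀ {e} → e ≤ α → (∀ b → ∃ λ π → + (p ^ e) ∣ weightedSum (b ∘ʳ π)) →
    ∀ c → (∀ i → + p ∣ c i - c zero) → ∃ λ π → + (p ^ suc e) ∣ weightedSum (c ∘ʳ π)
  congruent-step {e} e≤α balance c p∣ =
    let π , pᵉ∣ = balance b in
    π , subst (_∣ weightedSum (c ∘ʳ π)) (sym (ℤP.pos-* p (p ^ e)))
              (weightedSum-affine-∣ {x = c zero} {+ p} (c ∘ʳ π) (b ∘ʳ π) (λ k → c≡ (π ⟨$⟩ʳ k)) p*pᵉ∣triangular pᵉ∣)
    where
    b : Fin (suc n) → ℤ
    b i = quotient (p∣ i)
    c≡ : ∀ i → c i ≡ c zero + + p * b i
    c≡ i = trans (split (c i) (c zero)) (cong (λ z → c zero + z) (trans (_∣_.equality (p∣ i)) (ℤP.*-comm (b i) (+ p))))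
      where
      split : ∀ a a₀ → a ≡ a₀ + (a - a₀)
      split = solve-∀
    p*pᵉ∣triangular : + p * + (p ^ e) ∣ triangular (suc n)
    p*pᵉ∣triangular = subst (_∣ triangular (suc n)) (ℤP.pos-* p (p ^ e)) (pᵉ∣triangular (s≤s e≤α))

  prefix-length : ∀ {e} → suc e ≤ α → ∃ λ L → suc L ≡ p ^ suc e × suc L ≤ n
  prefix-length {e} e<α = L , L+1≡pᵉ⁺¹ , ℕP.≤-pred (subst₂ ℕ._<_ (sym L+1≡pᵉ⁺¹) (sym N≡pᵅ⁺¹) pᵉ⁺¹<pᵅ⁺¹)
    where
    instance
      pᵉ⁺¹≢0 : NonZero (p ^ suc e)
      pᵉ⁺¹≢0 = ℕP.m^n≢0 p (suc e)
    L = ℕ.pred (p ^ suc e)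
    L+1≡pᵉ⁺¹ : suc L ≡ p ^ suc e
    L+1≡pᵉ⁺¹ = ℕP.suc-pred (p ^ suc e)
    pᵉ⁺¹<pᵅ⁺¹ : p ^ suc e ℕ.< p ^ suc α
    pᵉ⁺¹<pᵅ⁺¹ = ℕP.^-monoʳ-< p (ℕ.nonTrivial⇒n>1 p {{prime⇒nonTrivial p-prime}}) (s≤s e<α)

  noncongruent-step : ∀ {e} → suc e ≤ α → ∀ c {i} → ¬ + p ∣ c i - c zero →
    ∃ λ π → + (p ^ suc e) ∣ weightedSum (c ∘ʳ π)
  noncongruent-step {e} e<α c p∤ =
    let L , L+1≡pᵉ⁺¹ , L+1≤n = prefix-length e<α
        π₁ , p∤U-0 = prefixSum-avoids (+ p) L+1≤n c p∤ 0ℤ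
        p∤U = λ p∣ → p∤U-0 (subst (+ p ∣_) (sym (ℤP.+-identityʳ (prefixSum (suc L) (c ∘ʳ π₁)))) p∣)
        π₂ , pᵉ⁺¹∣ = prime-power-prefix-balances {e = suc e} p-prime (ℕP.<⇒≤ L+1≤n) L+1≡pᵉ⁺¹ (c ∘ʳ π₁) p∤U
    in π₂ ∘ₚ π₁ , pᵉ⁺¹∣

  balance : ∀ e → e ≤ α → ∀ c → ∃ λ π → + (p ^ e) ∣ weightedSum (c ∘ʳ π)
  balance zero    _   c = id , ∣ᵤ⇒∣ (ℕ.1∣ _)
  balance (suc e) e<α c with all? (λ i → + p ∣? c i - c zero)
  ... | yes p∣ = congruent-step (ℕP.<⇒≤ e<α) (balance e (ℕP.<⇒≤ e<α)) c p∣
  ... | no ¬p∣ = noncongruent-step e<α c (proj₂ (¬∀⟶∃¬ _ _ (λ i → + p ∣? c i - c zero) ¬p∣))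

  balance-full : ∀ (a : Fin (suc n) → ℤ) → ¬ + p ∣ sum a ⊎ (∀ i → + p ∣ a i - a zero) →
    ∃ λ π → + (p ^ suc α) ∣ weightedSum (a ∘ʳ π)
  balance-full a (inj₁ p∤Σ) = prime-power-prefix-balances {e = suc α} p-prime ℕP.≤-refl N≡pᵅ⁺¹ a
                                (λ p∣ → p∤Σ (subst (_ ∣_) (prefixSum-all (suc n) a) p∣))
  balance-full a (inj₂ p∣) = congruent-step ℕP.≤-refl (balance α ℕP.≤-refl) a p∣

lemma2p2 : (p α : ℕ) → Prime p → p ≢ 2 → (a : Fin (p ^ suc α) → ℤ)
    → ((¬ ((+ p) Unsigned.∣ ∑ (p ^ suc α) a)) ⊎ (∀ i j → (+ p) Unsigned.∣ (a i - a j)))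
    → ∃ λ (σ : Permutation′ (p ^ suc α)) → (+ (p ^ suc α)) Unsigned.∣ ∑ (p ^ suc α) (λ k → (+ suc (toℕ k)) * a (σ ⟨$⟩ʳ k))
lemma2p2 p α p-prime p≢2 = arrange (p ^ suc α) refl
  where
  arrange : ∀ N → N ≡ p ^ suc α → (a : Fin N → ℤ)
    → ((¬ ((+ p) Unsigned.∣ ∑ N a)) ⊎ (∀ i j → (+ p) Unsigned.∣ (a i - a j)))
    → ∃ λ (σ : Permutation′ N) → (+ N) Unsigned.∣ ∑ N (λ k → (+ suc (toℕ k)) * a (σ ⟨$⟩ʳ k))
  arrange zero    0≡pᵅ⁺¹ _ _ = ⊥-elim (ℕ.≢-nonZero⁻¹ _ {{ℕP.m^n≢0 p (suc α) {{prime⇒nonZero p-prime}}}} (sym 0≡pᵅ⁺¹))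
  arrange (suc n) N≡pᵅ⁺¹ a hyp =
    let σ , pᵅ⁺¹∣ = balance-full {p} {α} p-prime (prime≢2⇒odd p-prime p≢2) N≡pᵅ⁺¹ a (⊎.map p∤Σ p∣differences hyp)
    in σ , ∣⇒∣ᵤ (subst₂ _∣_ (cong +_ (sym N≡pᵅ⁺¹)) (sym (∑≡sum (suc n) (λ k → + suc (toℕ k) * a (σ ⟨$⟩ʳ k)))) pᵅ⁺¹∣)
    where
    p∤Σ : ¬ + p Unsigned.∣ ∑ (suc n) a → ¬ + p ∣ sum a
    p∤Σ p∤ p∣ = p∤ (∣⇒∣ᵤ (subst (_ ∣_) (sym (∑≡sum (suc n) a)) p∣))
    p∣differences : (∀ i j → + p Unsigned.∣ a i - a j) → ∀ i → + p ∣ a i - a zero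
    p∣differences p∣ i = ∣ᵤ⇒∣ (p∣ i zero)
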